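{- For all integers $n \geq d \geq 1$, with the convention $j_0 = 0$, $$S(n,d) = \frac{1}{d!} \sum_{1\leq j_1<j_2<\cdots<j_{d-1}< n} \prod_{r=2}^{d} r^{\,j_{d-r+1}-j_{d-r}} = \frac{1}{d!} \sum_{1\leq j_1<j_2<\cdots<j_{d-1}< n} 1\cdot 2^{j_{d-1}-j_{d-2}}\cdot 3^{j_{d-2}-j_{d-3}}\cdots d^{\,j_1}.$$
   Context: $S(n,d)$ denotes the Stirling number of the second kind, i.e. the number of partitions of an $n$-element set into $d$ non-empty subsets. For $d=1$ the sum is over the empty tuple and consists of the single term $1$. -}

module Defs where

open import Data.Nat using (ℕ; zero; suc; _+_; _*_; _∸_; _^_)
open import Data.List using (List; []; _∷_; map; concatMap; upTo)
open import Data.Nat.ListAction using (sum; product)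

S : ℕ → ℕ → ℕ
S zero    zero    = 1
S (suc n) zero    = 0
S zero    (suc k) = 0
S (suc n) (suc k) = suc k * S n (suc k) + S n k

range : ℕ → ℕ → List ℕ
range lo hi = map (lo +_) (upTo (hi ∸ lo))

incSeqs : ℕ → ℕ → ℕ → List (List ℕ)
incSeqs zero    lo hi = [] ∷ []
incSeqs (suc k) lo hi =
  concatMap (λ j → map (j ∷_) (incSeqs k (suc j) hi)) (range lo hi)

-- J js i = j_i for the tuple js = (j₁,…,j_k), with the convention j₀ = 0
-- (out-of-range indices default to 0; never used below)
J : List ℕ → ℕ → ℕ
J js       zero    = 0
J []       (suc i) = 0
J (j ∷ js) (suc zero) = j
J (j ∷ js) (suc (suc i)) = J js (suc i)

term : ℕ → List ℕ → ℕ
term d js = product (map (λ r → r ^ (J js (d ∸ r + 1) ∸ J js (d ∸ r))) (range 2 (suc d)))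

stirlingSum : ℕ → ℕ → ℕ
stirlingSum n d = sum (map (term d) (incSeqs (d ∸ 1) 1 n))

{-# OPTIONS --safe #-}
-- Let the first index j₀ = p vary, and let T k p hi be the sum, for d = k+1, of
-- the summands over p < j₁ < ⋯ < j_k < hi.  Splitting off j₁ gives
-- T (k+1) p hi = Σ_{p < j < hi} (k+2)^(j-p) · T k j hi, and separating j = p+1
-- from the larger j (whose factor (k+2)^(j-p) is (k+2) times (k+2)^(j-p-1)) gives
-- T (k+1) p (p+m+2) = (k+2) · (T k (p+1) (p+m+2) + T (k+1) (p+1) (p+m+2)).
-- This is the recurrence of (k+1)! S(m+1, k+1), so the two agree.
module Submission where

open import Defs
open import Data.Nat using (ℕ; _*_; _≤_; _!)
open import Relation.Binary.PropositionalEquality using (_≡_)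

open import Data.Nat using (zero; suc; _+_; _∸_; _^_; _<_; s≤s; s≤s⁻¹; z<s)
open import Data.Nat.Properties
open import Data.Nat.ListAction using (sum; product)
open import Data.Nat.ListAction.Properties using (sum-++; product-++)
open import Data.Nat.Tactic.RingSolver using (solve-∀)
open import Data.List using (List; []; _∷_; [_]; _++_; map; concat; concatMap; upTo; applyUpTo)
open import Data.List.Properties
  using (map-cong; map-cong-local; map-∘; map-++; map-concatMap; map-applyUpTo; applyUpTo-∷ʳ)
open import Data.List.Relation.Unary.All as All using (All)
open import Data.List.Relation.Unary.All.Properties using (map⁺; all-upTo)
open import Data.Product using (_×_; _,_)
open import Function using (id; _∘_)
open import Relation.Binary.PropositionalEquality using (refl; sym; trans; cong; cong₂; module ≡-Reasoning)

open ≡-Reasoning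

sum-concat : (xss : List (List ℕ)) → sum (concat xss) ≡ sum (map sum xss)
sum-concat []         = refl
sum-concat (xs ∷ xss) = trans (sum-++ xs (concat xss)) (cong (sum xs +_) (sum-concat xss))

sum-map-concatMap : ∀ {A B : Set} (f : B → ℕ) (g : A → List B) (xs : List A) →
  sum (map f (concatMap g xs)) ≡ sum (map (λ x → sum (map f (g x))) xs)
sum-map-concatMap f g xs = begin
  sum (map f (concatMap g xs))              ≡⟨ cong sum (map-concatMap f g xs) ⟩
  sum (concat (map (map f ∘ g) xs))         ≡⟨ sum-concat (map (map f ∘ g) xs) ⟩
  sum (map sum (map (map f ∘ g) xs))        ≡⟨ cong sum (map-∘ xs) ⟨
  sum (map (λ x → sum (map f (g x))) xs)    ∎

sum-map-*ˡ : ∀ {A : Set} (c : ℕ) (f : A → ℕ) (xs : List A) →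
  sum (map (λ x → c * f x) xs) ≡ c * sum (map f xs)
sum-map-*ˡ c f []       = sym (*-zeroʳ c)
sum-map-*ˡ c f (x ∷ xs) = begin
  c * f x + sum (map (λ x → c * f x) xs)  ≡⟨ cong (c * f x +_) (sum-map-*ˡ c f xs) ⟩
  c * f x + c * sum (map f xs)            ≡⟨ *-distribˡ-+ c (f x) (sum (map f xs)) ⟨
  c * (f x + sum (map f xs))              ∎

range-empty : ∀ {lo hi} → hi ≤ lo → range lo hi ≡ []
range-empty {lo} hi≤lo = cong (map (lo +_) ∘ upTo) (m≤n⇒m∸n≡0 hi≤lo)

range-cons : ∀ {lo hi} → lo < hi → range lo hi ≡ lo ∷ range (suc lo) hi
range-cons {lo} {suc hi} (s≤s lo≤hi) = begin
  map (lo +_) (upTo (suc hi ∸ lo))             ≡⟨ cong (map (lo +_) ∘ upTo) (+-∸-assoc 1 lo≤hi) ⟩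
  lo + 0 ∷ map (lo +_) (applyUpTo suc n)       ≡⟨ cong₂ _∷_ (+-identityʳ lo) tail ⟩
  lo ∷ map (suc lo +_) (upTo n)                ∎
  where
  n = hi ∸ lo
  tail : map (lo +_) (applyUpTo suc n) ≡ map (suc lo +_) (upTo n)
  tail = begin
    map (lo +_) (applyUpTo suc n)           ≡⟨ cong (map (lo +_)) (map-applyUpTo id suc n) ⟨
    map (lo +_) (map suc (upTo n))          ≡⟨ map-∘ (upTo n) ⟨
    map (λ i → lo + suc i) (upTo n)         ≡⟨ map-cong (+-suc lo) (upTo n) ⟩
    map (suc lo +_) (upTo n)                ∎

range-bounded : ∀ lo hi → All (λ j → lo ≤ j × j < hi) (range lo hi)
range-bounded lo hi = map⁺ (All.map bounds (all-upTo (hi ∸ lo)))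
  where
  bounds : ∀ {i} → i < hi ∸ lo → lo ≤ lo + i × lo + i < hi
  bounds {i} i<hi∸lo = m≤m+n lo i , <-≤-trans (+-monoʳ-< lo i<hi∸lo) (≤-reflexive (m+[n∸m]≡n lo≤hi))
    where lo≤hi = <⇒≤ (m∸n≢0⇒n<m {hi} {lo} (m<n⇒n≢0 i<hi∸lo))

map-cong-range : ∀ {A : Set} {f g : ℕ → A} lo hi → (∀ {j} → lo ≤ j → j < hi → f j ≡ g j) →
  map f (range lo hi) ≡ map g (range lo hi)
map-cong-range lo hi eq = map-cong-local (All.map (λ (lo≤j , j<hi) → eq lo≤j j<hi) (range-bounded lo hi))

-- Indexes the whole tuple (j₀, j₁, …), so that j₀ need not be 0; like J it is 0
-- past the end.
at : List ℕ → ℕ → ℕ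
at []       _       = 0
at (x ∷ xs) zero    = x
at (x ∷ xs) (suc i) = at xs i

J≡at : ∀ js i → J js i ≡ at (0 ∷ js) i
J≡at js       zero          = refl
J≡at []       (suc i)       = refl
J≡at (j ∷ js) (suc zero)    = refl
J≡at (j ∷ js) (suc (suc i)) = J≡at js (suc i)

factor : ℕ → List ℕ → ℕ → ℕ
factor d xs r = r ^ (at xs (d ∸ r + 1) ∸ at xs (d ∸ r))

weight : ℕ → List ℕ → ℕ
weight d xs = product (map (factor d xs) (range 2 (suc d)))

term≡weight : ∀ d js → term d js ≡ weight d (0 ∷ js)
term≡weight d js = cong product (map-cong factor-eq (range 2 (suc d)))
  where
  factor-eq : ∀ r → r ^ (J js (d ∸ r + 1) ∸ J js (d ∸ r)) ≡ factor d (0 ∷ js) r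
  factor-eq r = cong₂ (λ a b → r ^ (a ∸ b)) (J≡at js (d ∸ r + 1)) (J≡at js (d ∸ r))

weight-cons : ∀ k p j js → weight (2 + k) (p ∷ j ∷ js) ≡ (2 + k) ^ (j ∸ p) * weight (suc k) (j ∷ js)
weight-cons k p j js = begin
  product (map f (map (2 +_) (upTo (suc k))))
    ≡⟨ cong (product ∘ map f) (trans (cong (map (2 +_)) (sym (applyUpTo-∷ʳ id k))) (map-++ (2 +_) (upTo k) [ k ])) ⟩
  product (map f (range 2 (2 + k) ++ [ 2 + k ]))
    ≡⟨ cong product (map-++ f (range 2 (2 + k)) [ 2 + k ]) ⟩
  product (map f (range 2 (2 + k)) ++ [ f (2 + k) ])
    ≡⟨ product-++ (map f (range 2 (2 + k))) [ f (2 + k) ] ⟩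
  product (map f (range 2 (2 + k))) * (f (2 + k) * 1)
    ≡⟨ cong₂ _*_ (cong product (map-cong-range 2 (2 + k) shift)) (trans (*-identityʳ _) outermost) ⟩
  weight (suc k) (j ∷ js) * (2 + k) ^ (j ∸ p)
    ≡⟨ *-comm (weight (suc k) (j ∷ js)) _ ⟩
  (2 + k) ^ (j ∸ p) * weight (suc k) (j ∷ js)
    ∎
  where
  xs = p ∷ j ∷ js
  f = factor (2 + k) xs
  outermost : f (2 + k) ≡ (2 + k) ^ (j ∸ p)
  outermost = cong (λ x → (2 + k) ^ (at xs (x + 1) ∸ at xs x)) (n∸n≡0 k)
  shift : ∀ {r} → 2 ≤ r → r < 2 + k → f r ≡ factor (suc k) (j ∷ js) r
  shift {r} _ r<2+k = cong (λ x → r ^ (at xs (x + 1) ∸ at xs x)) (+-∸-assoc 1 (s≤s⁻¹ r<2+k))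

tailSum : ℕ → ℕ → ℕ → ℕ
tailSum k p hi = sum (map (λ js → weight (suc k) (p ∷ js)) (incSeqs k (suc p) hi))

tailSum-suc : ∀ k p hi →
  tailSum (suc k) p hi ≡ sum (map (λ j → (2 + k) ^ (j ∸ p) * tailSum k j hi) (range (suc p) hi))
tailSum-suc k p hi = trans (sum-map-concatMap w (λ j → map (j ∷_) (incSeqs k (suc j) hi)) (range (suc p) hi))
                           (cong sum (map-cong split-first (range (suc p) hi)))
  where
  w : List ℕ → ℕ
  w js = weight (2 + k) (p ∷ js)
  split-first : ∀ j → sum (map w (map (j ∷_) (incSeqs k (suc j) hi))) ≡ (2 + k) ^ (j ∸ p) * tailSum k j hi
  split-first j = begin
    sum (map w (map (j ∷_) (incSeqs k (suc j) hi)))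
      ≡⟨ cong sum (map-∘ (incSeqs k (suc j) hi)) ⟨
    sum (map (λ js → w (j ∷ js)) (incSeqs k (suc j) hi))
      ≡⟨ cong sum (map-cong (weight-cons k p j) (incSeqs k (suc j) hi)) ⟩
    sum (map (λ js → (2 + k) ^ (j ∸ p) * weight (suc k) (j ∷ js)) (incSeqs k (suc j) hi))
      ≡⟨ sum-map-*ˡ ((2 + k) ^ (j ∸ p)) (λ js → weight (suc k) (j ∷ js)) (incSeqs k (suc j) hi) ⟩
    (2 + k) ^ (j ∸ p) * tailSum k j hi
      ∎

S-one : ∀ m → S (suc m) 1 ≡ 1
S-one zero    = refl
S-one (suc m) = cong (λ s → 1 * s + 0) (S-one m)

tailSum≡!*S : ∀ k p m → tailSum k p (suc p + m) ≡ suc k ! * S (suc m) (suc k)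
tailSum≡!*S zero    p m       = sym (trans (+-identityʳ _) (S-one m))
tailSum≡!*S (suc k) p zero    = begin
  tailSum (suc k) p (suc p + 0)  ≡⟨ tailSum-suc k p (suc p + 0) ⟩
  sum (map _ (range (suc p) (suc p + 0)))
    ≡⟨ cong (sum ∘ map _) (range-empty (≤-reflexive (+-identityʳ (suc p)))) ⟩
  0                              ≡⟨ *-zeroʳ ((2 + k) !) ⟨
  (2 + k) ! * 0                    ≡⟨ cong (λ s → (2 + k) ! * (s + 0)) (*-zeroʳ (2 + k)) ⟨
  (2 + k) ! * S 1 (2 + k)          ∎
tailSum≡!*S (suc k) p (suc m) = begin
  tailSum (suc k) p hi
    ≡⟨ tailSum-suc k p hi ⟩
  sum (map g (range (suc p) hi))
    ≡⟨ cong (sum ∘ map g) (range-cons (s≤s (m<m+n p z<s))) ⟩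
  c ^ (suc p ∸ p) * t (suc p) + sum (map g (range (2 + p) hi))
    ≡⟨ cong₂ _+_ (cong (λ e → c ^ e * t (suc p)) (m+n∸n≡m 1 p)) (cong sum (map-cong-range (2 + p) hi shift)) ⟩
  c ^ 1 * t (suc p) + sum (map (λ j → c * (c ^ (j ∸ suc p) * t j)) (range (2 + p) hi))
    ≡⟨ cong₂ _+_ (cong (_* t (suc p)) (*-identityʳ c)) (sum-map-*ˡ c _ (range (2 + p) hi)) ⟩
  c * t (suc p) + c * sum (map (λ j → c ^ (j ∸ suc p) * t j) (range (2 + p) hi))
    ≡⟨ cong (λ s → c * t (suc p) + c * s) (tailSum-suc k (suc p) hi) ⟨
  c * t (suc p) + c * tailSum (suc k) (suc p) hi
    ≡⟨ cong (λ h → c * tailSum k (suc p) h + c * tailSum (suc k) (suc p) h) (+-suc (suc p) m) ⟩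
  c * tailSum k (suc p) (2 + p + m) + c * tailSum (suc k) (suc p) (2 + p + m)
    ≡⟨ cong₂ (λ a b → c * a + c * b) (tailSum≡!*S k (suc p) m) (tailSum≡!*S (suc k) (suc p) m) ⟩
  c * (suc k ! * S (suc m) (suc k)) + c * (c ! * S (suc m) c)
    ≡⟨ stirling-recurrence c (suc k !) (S (suc m) (suc k)) (S (suc m) c) ⟩
  c ! * S (2 + m) c
    ∎
  where
  c = 2 + k
  hi = suc p + suc m
  t : ℕ → ℕ
  t j = tailSum k j hi
  g : ℕ → ℕ
  g j = c ^ (j ∸ p) * t j
  shift : ∀ {j} → 2 + p ≤ j → j < hi → g j ≡ c * (c ^ (j ∸ suc p) * t j)
  shift {suc j} (s≤s p<j) _ = trans (cong (λ e → c ^ e * t (suc j)) (+-∸-assoc 1 (<⇒≤ p<j))) (*-assoc c (c ^ (j ∸ p)) (t (suc j)))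
  stirling-recurrence : ∀ c f a b → c * (f * a) + c * ((c * f) * b) ≡ (c * f) * (c * b + a)
  stirling-recurrence = solve-∀

mainTheorem2 : (n d : ℕ) → 1 ≤ d → d ≤ n →
    (d !) * S n d ≡ stirlingSum n d
mainTheorem2 (suc n) (suc k) _ _ = begin
  suc k ! * S (suc n) (suc k)                              ≡⟨ tailSum≡!*S k 0 n ⟨
  tailSum k 0 (suc n)                                      ≡⟨ cong sum (map-cong (term≡weight (suc k)) (incSeqs k 1 (suc n))) ⟨
  sum (map (term (suc k)) (incSeqs k 1 (suc n)))           ∎
mainTheorem2 zero (suc k) _ ()
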